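{- Consider the following four statements. (C1) If $\mathcal{F}$ is a finite union-closed family of sets with $\emptyset\notin\mathcal{F}$, then some element belongs to more than half of the sets of $\mathcal{F}$. (C2) If $\mathcal{F}$ is a finite union-closed family of sets with $\emptyset\notin\mathcal{F}$ and precisely one element belongs to more than half of the sets of $\mathcal{F}$, then this element belongs to every set of $\mathcal{F}$. (C3) If $\mathcal{F}$ is a finite union-closed twin-free family of sets with $\emptyset\notin\mathcal{F}$, $M$ is the largest set of $\mathcal{F}$, and precisely one element $x$ belongs to more than half of the sets of $\mathcal{F}$, then $\mathcal{F}$ is exactly the family of all subsets of $M$ containing $x$. (C4) If $\mathcal{F}$ is a finite union-closed family of sets whose smallest set has size at least $2$, then there are at least two elements each of which belongs to more than half of the sets of $\mathcal{F}$. Then (C3) implies (C2), (C2) implies (C4), and (C4) implies (C1).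
   Context: A family of sets is a collection of pairwise distinct sets; it is union-closed if the union of any two of its sets belongs to it. Two elements $a,b$ are twins in $\mathcal{F}$ if every $A\in\mathcal{F}$ satisfies $|A\cap\{a,b\}|\neq 1$; $\mathcal{F}$ is twin-free if it has no twins. -}

module Defs where

open import Data.Nat using (ℕ; _*_; _<_; _≤_)
open import Data.Fin using (Fin)
open import Data.Fin.Subset as S using (Subset; _∪_; _⊆_; ∣_∣)
open import Data.Fin.Subset.Properties using (_∈?_)
open import Data.List using (List; []; length; filter)
open import Data.List.Membership.Propositional using (_∈_; _∉_)
open import Data.List.Relation.Unary.Unique.Propositional using (Unique)
open import Data.Product using (Σ; _×_; ∃; ∃-syntax; _,_)
open import Relation.Nullary using (¬_)
open import Relation.Binary.PropositionalEquality using (_≡_; _≢_)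
open import Function.Bundles using (_⇔_)

-- A finite family of sets over the ground set Fin n: a duplicate-free list of subsets.
-- (Every finite family of sets has a finite union, so WLOG the ground set is Fin n.)
Family : ℕ → Set
Family n = List (Subset n)

-- a "family of sets" consists of pairwise distinct sets; nonempty by convention
IsFamily : ∀ {n} → Family n → Set
IsFamily F = Unique F × F ≢ []

UnionClosed : ∀ {n} → Family n → Set
UnionClosed F = ∀ A B → A ∈ F → B ∈ F → (A ∪ B) ∈ F

deg : ∀ {n} → Fin n → Family n → ℕ
deg x F = length (filter (x ∈?_) F)

Abundant : ∀ {n} → Family n → Fin n → Set
Abundant F x = length F < 2 * deg x F

InUniverse : ∀ {n} → Family n → Fin n → Set
InUniverse F x = ∃[ A ] (A ∈ F × x S.∈ A)

Twins : ∀ {n} → Family n → Fin n → Fin n → Set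
Twins F a b = a ≢ b × InUniverse F a × InUniverse F b
            × (∀ A → A ∈ F → (a S.∈ A ⇔ b S.∈ A))

TwinFree : ∀ {n} → Family n → Set
TwinFree F = ∀ a b → ¬ Twins F a b

UniqueAbundant : ∀ {n} → Family n → Fin n → Set
UniqueAbundant F x = Abundant F x × (∀ y → Abundant F y → y ≡ x)

C1 : Set
C1 = ∀ n (F : Family n) → IsFamily F → UnionClosed F → S.⊥ ∉ F
     → ∃[ x ] Abundant F x

C2 : Set
C2 = ∀ n (F : Family n) → IsFamily F → UnionClosed F → S.⊥ ∉ F
     → ∀ x → UniqueAbundant F x → ∀ A → A ∈ F → x S.∈ A

C3 : Set
C3 = ∀ n (F : Family n) → IsFamily F → UnionClosed F → TwinFree F → S.⊥ ∉ F
     → ∀ M → M ∈ F → (∀ A → A ∈ F → A ⊆ M)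
     → ∀ x → UniqueAbundant F x
     → ∀ A → (A ∈ F ⇔ (A ⊆ M × x S.∈ A))

C4 : Set
C4 = ∀ n (F : Family n) → IsFamily F → UnionClosed F
     → (∀ A → A ∈ F → 2 ≤ ∣ A ∣)
     → ∃[ x ] ∃[ y ] (x ≢ y × Abundant F x × Abundant F y)

-- C3 ⇒ C2: deleting one of two twins preserves union-closedness, distinctness of the
-- sets, ∅ ∉ F and the uniquely abundant element (twins have equal degree, so neither
-- twin is that element). By induction on the ground set F may be assumed twin-free,
-- and then C3 exhibits F as the family of all subsets of its largest set containing x.
--
-- C2 ⇒ C1: on a new point 0 form {A + 0 : A ∈ F ∪ {∅}} ∪ F. The point 0 lies in
-- |F| + 1 of its 2|F| + 1 sets, and every other abundant element is abundant in F.
-- So if F had no abundant element, 0 would be the unique one, and C2 would force 0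
-- into the copies of the sets of F.
--
-- C2 ⇒ C4: C1 (which follows from C2) yields an abundant x. If x lies in every set,
-- deleting x leaves a family without ∅ to which C1 applies again; otherwise C2 says
-- that x cannot be the only abundant element.
--
-- C4 ⇒ C1: add a new point to every set.
module Submission where

open import Data.Empty using (⊥-elim)
open import Data.Fin using (Fin; zero; suc; punchIn; punchOut; _≟_)
open import Data.Fin.Properties
  using (any?; punchInᵢ≢i; punchIn-injective; punchIn-punchOut; punchOut-punchIn)
open import Data.Fin.Subset as S
  using (Subset; ⊥; ⁅_⁆; _∪_; _⊆_; ∣_∣; ⋃; Empty; inside; outside)
open import Data.Fin.Subset.Properties
  using (_∈?_; ∉⊥; drop-there; x∈⁅x⁆; x∈⁅y⁆⇒x≡y; ∣⁅x⁆∣≡1; ∣⊥∣≡0; p⊆q⇒∣p∣≤∣q∣;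
         Empty-unique; p⊆p∪q; q⊆p∪q; ∪-identityˡ; ∪-identityʳ)
open import Data.List using ([]; _∷_; map; filter; length; _++_)
open import Data.List.Properties
  using (length-map; length-++; filter-++; filter-all; filter-none; filter-reject; map-id)
open import Data.List.Membership.Propositional using (_∈_; _∉_)
open import Data.List.Membership.Propositional.Properties
  using (∈-map⁺; ∈-map⁻; ∈-++⁺ˡ; ∈-++⁺ʳ; ∈-++⁻)
open import Data.List.Relation.Binary.Disjoint.Propositional using (Disjoint)
open import Data.List.Relation.Unary.All as All using (All; []; _∷_)
open import Data.List.Relation.Unary.All.Properties as Allₚ using (¬Any⇒All¬)
open import Data.List.Relation.Unary.Any using (here; there)
open import Data.List.Relation.Unary.AllPairs using ([]; _∷_)
open import Data.List.Relation.Unary.Unique.Propositional using (Unique)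
import Data.List.Relation.Unary.Unique.Propositional.Properties as Unique
open import Data.Nat using (ℕ; suc; _+_; _*_; _<_; _≤_; s≤s; z≤n; _<?_)
open import Data.Nat.Properties
  using (≤-trans; n≮n; n<1+n; n≤1+n; <⇒≱; ≰⇒>; +-identityʳ; +-monoʳ-<; +-mono-≤;
         *-distribˡ-+; module ≤-Reasoning)
open import Data.Product using (_×_; ∃-syntax; ∃₂; _,_; proj₁; proj₂; uncurry)
open import Data.Sum as Sum using (_⊎_; inj₁; inj₂)
open import Data.Vec using (Vec; []; _∷_; lookup; removeAt; insertAt; here; there)
open import Data.Vec.Properties
  using (∷-injectiveʳ; removeAt-punchOut; insertAt-removeAt; []=⇒lookup; lookup⇒[]=)
open import Function using (_∘_; id)
open import Function.Bundles using (_⇔_; mk⇔; Equivalence)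
open import Function.Properties.Equivalence using () renaming (refl to ⇔-refl)
open import Level using (Level)
open import Relation.Nullary using (¬_; Dec; yes; no; contradiction)
open import Relation.Nullary.Decidable using (map′; ¬?; _×-dec_; _→-dec_; decidable-stable)
open import Relation.Binary.PropositionalEquality
  using (_≡_; _≢_; refl; sym; trans; cong; cong₂; subst; subst₂; module ≡-Reasoning)

open import Defs

open Equivalence using (to; from)

private variable
  a : Level
  A : Set a
  m n : ℕ

removeAt-injective : ∀ (xs ys : Vec A (suc n)) i →
                     lookup xs i ≡ lookup ys i → removeAt xs i ≡ removeAt ys i → xs ≡ ys
removeAt-injective xs ys i xᵢ≡yᵢ eq = begin
  xs                                       ≡⟨ insertAt-removeAt xs i ⟨
  insertAt (removeAt xs i) i (lookup xs i) ≡⟨ cong₂ (λ zs z → insertAt zs i z) eq xᵢ≡yᵢ ⟩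
  insertAt (removeAt ys i) i (lookup ys i) ≡⟨ insertAt-removeAt ys i ⟩
  ys                                       ∎
  where open ≡-Reasoning

removeAt-∪ : ∀ (p q : Subset (suc n)) i → removeAt (p ∪ q) i ≡ removeAt p i ∪ removeAt q i
removeAt-∪ (_ ∷ _)         (_ ∷ _)         zero    = refl
removeAt-∪ (_ ∷ p@(_ ∷ _)) (_ ∷ q@(_ ∷ _)) (suc i) = cong (_ ∷_) (removeAt-∪ p q i)

⇔⇒lookup≡ : ∀ {p q : Subset n} {i j} → (i S.∈ p ⇔ j S.∈ q) → lookup p i ≡ lookup q j
⇔⇒lookup≡ {p = p} {q} {i} {j} i∈p⇔j∈q with lookup p i in pᵢ | lookup q j in qⱼ
... | inside  | inside  = refl
... | outside | outside = refl
... | inside  | outside =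
  contradiction (trans (sym ([]=⇒lookup (to i∈p⇔j∈q (lookup⇒[]= i p pᵢ)))) qⱼ) λ ()
... | outside | inside  =
  contradiction (trans (sym ([]=⇒lookup (from i∈p⇔j∈q (lookup⇒[]= j q qⱼ)))) pᵢ) λ ()

∈-removeAt : ∀ (p : Subset (suc n)) {i j} (i≢j : i ≢ j) →
             punchOut i≢j S.∈ removeAt p i ⇔ j S.∈ p
∈-removeAt p {i} {j} i≢j = mk⇔
  (λ j'∈ → lookup⇒[]= j p (trans (sym (removeAt-punchOut p i≢j)) ([]=⇒lookup j'∈)))
  (λ j∈ → lookup⇒[]= _ (removeAt p i) (trans (removeAt-punchOut p i≢j) ([]=⇒lookup j∈)))

∈-removeAt-punchIn : ∀ (p : Subset (suc n)) i j → j S.∈ removeAt p i ⇔ punchIn i j S.∈ p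
∈-removeAt-punchIn p i j =
  subst (λ k → k S.∈ removeAt p i ⇔ punchIn i j S.∈ p) (punchOut-punchIn i)
        (∈-removeAt p (punchInᵢ≢i i j ∘ sym))

removeAt≡⊥⇒⊆⁅i⁆ : ∀ (p : Subset (suc n)) i → removeAt p i ≡ ⊥ → p ⊆ ⁅ i ⁆
removeAt≡⊥⇒⊆⁅i⁆ p i eq {j} j∈p with i ≟ j
... | yes refl = x∈⁅x⁆ i
... | no  i≢j  = ⊥-elim (∉⊥ (subst (punchOut i≢j S.∈_) eq (from (∈-removeAt p i≢j) j∈p)))

p≢⊥⇒0<∣p∣ : ∀ {p : Subset n} → p ≢ ⊥ → 0 < ∣ p ∣
p≢⊥⇒0<∣p∣ {p = []}          p≢⊥ = contradiction refl p≢⊥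
p≢⊥⇒0<∣p∣ {p = inside  ∷ _} _   = s≤s z≤n
p≢⊥⇒0<∣p∣ {p = outside ∷ _} p≢⊥ = p≢⊥⇒0<∣p∣ (p≢⊥ ∘ cong (outside ∷_))

∈-∷ : ∀ {b} {p : Subset n} {y} → suc y S.∈ (b ∷ p) ⇔ y S.∈ p
∈-∷ = mk⇔ drop-there there

map-≢[] : ∀ {b} {B : Set b} {f : A → B} {xs} → xs ≢ [] → map f xs ≢ []
map-≢[] {xs = []} []≢[] _ = []≢[] refl

map⁺-injectiveOn : ∀ {b} {B : Set b} (f : A → B) {xs} →
                   (∀ {x y} → x ∈ xs → y ∈ xs → f x ≡ f y → x ≡ y) →
                   Unique xs → Unique (map f xs)
map⁺-injectiveOn f inj [] = []
map⁺-injectiveOn f inj (x∉xs ∷ xs!) =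
  Allₚ.map⁺ (All.tabulate λ y∈ fx≡fy → All.lookup x∉xs y∈ (inj (here refl) (there y∈) fx≡fy))
  ∷ map⁺-injectiveOn f (λ x∈ y∈ → inj (there x∈) (there y∈)) xs!

1+m+m<2*[1+m] : ∀ m → suc m + m < 2 * suc m
1+m+m<2*[1+m] m = begin-strict
  suc m + m         <⟨ +-monoʳ-< (suc m) (n<1+n m) ⟩
  suc m + suc m     ≡⟨ cong (suc m +_) (+-identityʳ (suc m)) ⟨
  2 * suc m         ∎
  where open ≤-Reasoning

1+m+m<2*[n+n]⇒m<2*n : ∀ {m n} → suc m + m < 2 * (n + n) → m < 2 * n
1+m+m<2*[n+n]⇒m<2*n {m} {n} h = ≰⇒> λ 2n≤m → <⇒≱ h (begin
  2 * (n + n)       ≡⟨ *-distribˡ-+ 2 n n ⟩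
  2 * n + 2 * n     ≤⟨ +-mono-≤ 2n≤m 2n≤m ⟩
  m + m             ≤⟨ n≤1+n (m + m) ⟩
  suc m + m         ∎)
  where open ≤-Reasoning

deg-++ : ∀ (x : Fin n) F G → deg x (F ++ G) ≡ deg x F + deg x G
deg-++ x F G = trans (cong length (filter-++ (x ∈?_) F G)) (length-++ (filter (x ∈?_) F))

deg-all : ∀ {x : Fin n} {F} → All (x S.∈_) F → deg x F ≡ length F
deg-all x∈F = cong length (filter-all (_ ∈?_) x∈F)

deg-none : ∀ {x : Fin n} {F} → All (x S.∉_) F → deg x F ≡ 0
deg-none x∉F = cong length (filter-none (_ ∈?_) x∉F)

deg-map : ∀ (f : Subset m → Subset n) {y y'} F →
          (∀ {A} → A ∈ F → y S.∈ f A ⇔ y' S.∈ A) → deg y (map f F) ≡ deg y' F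
deg-map f []                  _ = refl
deg-map f {y} {y'} (A ∷ F) y⇔y' with y ∈? f A | y' ∈? A
... | yes _  | yes _  = cong suc (deg-map f F (y⇔y' ∘ there))
... | no  _  | no  _  = deg-map f F (y⇔y' ∘ there)
... | yes y∈ | no y'∉ = contradiction (to (y⇔y' (here refl)) y∈) y'∉
... | no y∉  | yes y'∈ = contradiction (from (y⇔y' (here refl)) y'∈) y∉

Abundant-map : ∀ (f : Subset m → Subset n) {y y'} F →
               (∀ {A} → A ∈ F → y S.∈ f A ⇔ y' S.∈ A) → Abundant (map f F) y ⇔ Abundant F y'
Abundant-map f F y⇔y' =
  subst (Abundant (map f F) _ ⇔_)
        (cong₂ (λ l d → l < 2 * d) (length-map f F) (deg-map f F y⇔y')) ⇔-refl

Abundant-twin : ∀ {F : Family n} {a b} →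
                (∀ {A} → A ∈ F → a S.∈ A ⇔ b S.∈ A) → Abundant F b → Abundant F a
Abundant-twin {F = F} tw = subst (λ G → Abundant G _) (map-id F) ∘ from (Abundant-map id F tw)

otherAbundant-or-unique : ∀ (F : Family n) {x} → Abundant F x →
                          (∃[ y ] (y ≢ x × Abundant F y)) ⊎ UniqueAbundant F x
otherAbundant-or-unique F {x} abx
  with any? (λ y → ¬? (y ≟ x) ×-dec (length F <? 2 * deg y F))
... | yes other  = inj₁ other
... | no ¬other = inj₂ (abx , λ y aby → decidable-stable (y ≟ x) λ y≢x → ¬other (y , y≢x , aby))

_⇔?_ : ∀ {b} {P : Set a} {Q : Set b} → Dec P → Dec Q → Dec (P ⇔ Q)
P? ⇔? Q? = map′ (uncurry mk⇔) (λ P⇔Q → to P⇔Q , from P⇔Q) ((P? →-dec Q?) ×-dec (Q? →-dec P?))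

-- The twins found need not lie in the universe of F; deleting one of them is harmless anyway.
twins-or-twinFree : ∀ (F : Family n) →
                    (∃₂ λ a b → a ≢ b × (∀ {A} → A ∈ F → a S.∈ A ⇔ b S.∈ A)) ⊎ TwinFree F
twins-or-twinFree F
  with any? (λ a → any? λ b → ¬? (a ≟ b) ×-dec All.all? (λ A → (a ∈? A) ⇔? (b ∈? A)) F)
... | yes (a , b , a≢b , tw) = inj₁ (a , b , a≢b , All.lookup tw)
... | no ¬twins = inj₂ λ a b (a≢b , _ , _ , tw) → ¬twins (a , b , a≢b , All.tabulate (tw _))

⋃-∈ : ∀ {F : Family n} → UnionClosed F → ∀ {A} L → A ∈ F → All (_∈ F) L → ⋃ (A ∷ L) ∈ F
⋃-∈ {F = F} _ {A} [] A∈F [] = subst (_∈ F) (sym (∪-identityʳ A)) A∈F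
⋃-∈ uc {A} (B ∷ L) A∈F (B∈F ∷ L⊆F) = uc A (⋃ (B ∷ L)) A∈F (⋃-∈ uc L B∈F L⊆F)

⊆-⋃ : ∀ {A : Subset n} {F} → A ∈ F → A ⊆ ⋃ F
⊆-⋃ {F = _ ∷ F} (here refl) = p⊆p∪q (⋃ F)
⊆-⋃ {F = B ∷ F} (there A∈F) = q⊆p∪q B (⋃ F) ∘ ⊆-⋃ A∈F

⋃-maximum : ∀ {F : Family n} → F ≢ [] → UnionClosed F → ⋃ F ∈ F × (∀ A → A ∈ F → A ⊆ ⋃ F)
⋃-maximum {F = []}    []≢[] _ = contradiction refl []≢[]
⋃-maximum {F = A ∷ L} _     uc = ⋃-∈ uc L (here refl) (All.tabulate there) , λ _ → ⊆-⋃

map-unionClosed : ∀ (f : Subset m → Subset n) {F} →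
                  (∀ A B → f (A ∪ B) ≡ f A ∪ f B) → UnionClosed F → UnionClosed (map f F)
map-unionClosed f {F} f-∪ uc _ _ A'∈ B'∈ with ∈-map⁻ f A'∈ | ∈-map⁻ f B'∈
... | A , A∈F , refl | B , B∈F , refl = subst (_∈ map f F) (f-∪ A B) (∈-map⁺ f (uc A B A∈F B∈F))

⊥∷-unionClosed : ∀ {F : Family n} → UnionClosed F → UnionClosed (⊥ ∷ F)
⊥∷-unionClosed {F = F} _  _ _ (here refl) (here refl) =
  subst (_∈ ⊥ ∷ F) (sym (∪-identityʳ ⊥)) (here refl)
⊥∷-unionClosed {F = F} _  _ B (here refl) (there B∈F) =
  subst (_∈ ⊥ ∷ F) (sym (∪-identityˡ B)) (there B∈F)
⊥∷-unionClosed {F = F} _  A _ (there A∈F) (here refl) =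
  subst (_∈ ⊥ ∷ F) (sym (∪-identityʳ A)) (there A∈F)
⊥∷-unionClosed         uc A B (there A∈F) (there B∈F) = there (uc A B A∈F B∈F)

delete : Fin (suc n) → Family (suc n) → Family n
delete i = map (λ A → removeAt A i)

delete-unionClosed : ∀ {F : Family (suc n)} i → UnionClosed F → UnionClosed (delete i F)
delete-unionClosed i = map-unionClosed _ (λ A B → removeAt-∪ A B i)

delete-unique : ∀ {F : Family (suc n)} i →
                (∀ {A B} → A ∈ F → B ∈ F → removeAt A i ≡ removeAt B i → lookup A i ≡ lookup B i) →
                Unique F → Unique (delete i F)
delete-unique i separates =
  map⁺-injectiveOn _ λ A∈F B∈F eq → removeAt-injective _ _ i (separates A∈F B∈F eq) eq

delete-⊥∉ : ∀ {F : Family (suc n)} i → (∀ {A} → A ∈ F → ¬ A ⊆ ⁅ i ⁆) → ⊥ ∉ delete i F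
delete-⊥∉ i A⊈⁅i⁆ ⊥∈ with ∈-map⁻ _ ⊥∈
... | A , A∈F , ⊥≡ = A⊈⁅i⁆ A∈F (removeAt≡⊥⇒⊆⁅i⁆ A i (sym ⊥≡))

Abundant-delete : ∀ (F : Family (suc n)) i j → Abundant (delete i F) j ⇔ Abundant F (punchIn i j)
Abundant-delete F i j = Abundant-map _ F λ {A} _ → ∈-removeAt-punchIn A i j

delete-uniqueAbundant : ∀ {F : Family (suc n)} {i x} (i≢x : i ≢ x) →
                        UniqueAbundant F x → UniqueAbundant (delete i F) (punchOut i≢x)
delete-uniqueAbundant {F = F} {i} i≢x (abx , unique) =
    from (Abundant-delete F i _) (subst (Abundant F) (sym (punchIn-punchOut i≢x)) abx)
  , λ y aby → punchIn-injective i y _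
      (trans (unique _ (to (Abundant-delete F i y) aby)) (sym (punchIn-punchOut i≢x)))

module _ {F : Family (suc n)} {a b} (a≢b : a ≢ b)
         (tw : ∀ {A} → A ∈ F → a S.∈ A ⇔ b S.∈ A) where

  twin-delete-unique : Unique F → Unique (delete b F)
  twin-delete-unique = delete-unique b separates
    where
    b≢a : b ≢ a
    b≢a = a≢b ∘ sym
    separates : ∀ {A B} → A ∈ F → B ∈ F → removeAt A b ≡ removeAt B b → lookup A b ≡ lookup B b
    separates {A} {B} A∈F B∈F eq = begin
      lookup A b                           ≡⟨ ⇔⇒lookup≡ (tw A∈F) ⟨
      lookup A a                           ≡⟨ removeAt-punchOut A b≢a ⟨
      lookup (removeAt A b) (punchOut b≢a) ≡⟨ cong (λ C → lookup C (punchOut b≢a)) eq ⟩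
      lookup (removeAt B b) (punchOut b≢a) ≡⟨ removeAt-punchOut B b≢a ⟩
      lookup B a                           ≡⟨ ⇔⇒lookup≡ (tw B∈F) ⟩
      lookup B b                           ∎
      where open ≡-Reasoning

  -- A set inside ⁅ b ⁆ that contained b would also contain its twin a.
  twin-delete-⊥∉ : ⊥ ∉ F → ⊥ ∉ delete b F
  twin-delete-⊥∉ ⊥∉F = delete-⊥∉ b λ {A} A∈F A⊆⁅b⁆ →
    let empty : Empty A
        empty (j , j∈A) =
          let b∈A = subst (S._∈ A) (x∈⁅y⁆⇒x≡y b (A⊆⁅b⁆ j∈A)) j∈A
          in  a≢b (x∈⁅y⁆⇒x≡y b (A⊆⁅b⁆ (from (tw A∈F) b∈A)))
    in  ⊥∉F (subst (_∈ F) (Empty-unique empty) A∈F)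

  twin-≢-uniqueAbundant : ∀ {x} → UniqueAbundant F x → b ≢ x
  twin-≢-uniqueAbundant (abx , unique) refl = a≢b (unique a (Abundant-twin tw abx))

glue : Family n → Family n → Family (suc n)
glue P Q = map (inside ∷_) P ++ map (outside ∷_) Q

∈-glue⁻ : ∀ {P Q : Family n} {A'} → A' ∈ glue P Q →
          (∃[ A ] (A ∈ P × A' ≡ inside ∷ A)) ⊎ (∃[ A ] (A ∈ Q × A' ≡ outside ∷ A))
∈-glue⁻ {P = P} A'∈ = Sum.map (∈-map⁻ _) (∈-map⁻ _) (∈-++⁻ (map (inside ∷_) P) A'∈)

glue-unique : ∀ {P Q : Family n} → Unique P → Unique Q → Unique (glue P Q)
glue-unique {P = P} {Q} P! Q! =
  Unique.++⁺ (Unique.map⁺ ∷-injectiveʳ P!) (Unique.map⁺ ∷-injectiveʳ Q!) disjoint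
  where
  disjoint : Disjoint (map (inside ∷_) P) (map (outside ∷_) Q)
  disjoint (A'∈P , A'∈Q) with ∈-map⁻ _ A'∈P | ∈-map⁻ _ A'∈Q
  ... | _ , _ , refl | _ , _ , ()

glue-unionClosed : ∀ {P Q : Family n} → UnionClosed P → UnionClosed Q →
                   (∀ {A} → A ∈ Q → A ∈ P) → UnionClosed (glue P Q)
glue-unionClosed {P = P} {Q} ucP ucQ Q⊆P _ _ A'∈ B'∈
  with ∈-glue⁻ {P = P} {Q} A'∈ | ∈-glue⁻ {P = P} {Q} B'∈
... | inj₁ (A , A∈P , refl) | inj₁ (B , B∈P , refl) = ∈-++⁺ˡ (∈-map⁺ _ (ucP A B A∈P B∈P))
... | inj₁ (A , A∈P , refl) | inj₂ (B , B∈Q , refl) = ∈-++⁺ˡ (∈-map⁺ _ (ucP A B A∈P (Q⊆P B∈Q)))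
... | inj₂ (A , A∈Q , refl) | inj₁ (B , B∈P , refl) = ∈-++⁺ˡ (∈-map⁺ _ (ucP A B (Q⊆P A∈Q) B∈P))
... | inj₂ (A , A∈Q , refl) | inj₂ (B , B∈Q , refl) =
  ∈-++⁺ʳ (map (inside ∷_) P) (∈-map⁺ _ (ucQ A B A∈Q B∈Q))

glue-⊥∉ : ∀ {P Q : Family n} → ⊥ ∉ Q → ⊥ ∉ glue P Q
glue-⊥∉ {Q = Q} ⊥∉Q ⊥∈ with ∈-glue⁻ ⊥∈
... | inj₁ (_ , _ , ())
... | inj₂ (A , A∈Q , ⊥≡) = ⊥∉Q (subst (_∈ Q) (sym (∷-injectiveʳ ⊥≡)) A∈Q)

length-glue : ∀ (P Q : Family n) → length (glue P Q) ≡ length P + length Q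
length-glue P Q =
  trans (length-++ (map (inside ∷_) P)) (cong₂ _+_ (length-map _ P) (length-map _ Q))

deg-glue-zero : ∀ (P Q : Family n) → deg zero (glue P Q) ≡ length P
deg-glue-zero P Q = begin
  deg zero (glue P Q)                                          ≡⟨ deg-++ zero (map (inside ∷_) P) _ ⟩
  deg zero (map (inside ∷_) P) + deg zero (map (outside ∷_) Q) ≡⟨ cong₂ _+_ in₀ out₀ ⟩
  length (map (inside ∷_) P) + 0                               ≡⟨ +-identityʳ _ ⟩
  length (map (inside ∷_) P)                                   ≡⟨ length-map _ P ⟩
  length P                                                     ∎
  where
  open ≡-Reasoning
  in₀ = deg-all (Allₚ.map⁺ (All.universal (λ _ → here) P))
  out₀ = deg-none (Allₚ.map⁺ (All.universal (λ _ ()) Q))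

deg-glue-suc : ∀ (P Q : Family n) y → deg (suc y) (glue P Q) ≡ deg y P + deg y Q
deg-glue-suc P Q y = trans (deg-++ (suc y) (map (inside ∷_) P) _)
                           (cong₂ _+_ (deg-map _ P λ _ → ∈-∷) (deg-map _ Q λ _ → ∈-∷))

double : Family n → Family (suc n)
double F = glue (⊥ ∷ F) F

Abundant-double-zero : ∀ (F : Family n) → Abundant (double F) zero
Abundant-double-zero F =
  subst₂ (λ l d → l < 2 * d) (sym (length-glue (⊥ ∷ F) F)) (sym (deg-glue-zero (⊥ ∷ F) F))
         (1+m+m<2*[1+m] (length F))

Abundant-double-suc : ∀ (F : Family n) y → Abundant (double F) (suc y) → Abundant F y
Abundant-double-suc F y aby = 1+m+m<2*[n+n]⇒m<2*n {length F} {deg y F}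
  (subst₂ (λ l d → l < 2 * d) (length-glue (⊥ ∷ F) F) deg-suc aby)
  where
  deg-suc : deg (suc y) (double F) ≡ deg y F + deg y F
  deg-suc = trans (deg-glue-suc (⊥ ∷ F) F y)
                  (cong (_+ deg y F) (cong length (filter-reject (y ∈?_) ∉⊥)))

double-isFamily : ∀ {F : Family n} → Unique F → ⊥ ∉ F → IsFamily (double F)
double-isFamily {F = F} F! ⊥∉F = glue-unique (¬Any⇒All¬ F ⊥∉F ∷ F!) F! , λ ()

double-unionClosed : ∀ {F : Family n} → UnionClosed F → UnionClosed (double F)
double-unionClosed uc = glue-unionClosed (⊥∷-unionClosed uc) uc there

double-⊥∉ : ∀ {F : Family n} → ⊥ ∉ F → ⊥ ∉ double F
double-⊥∉ {F = F} = glue-⊥∉ {P = ⊥ ∷ F}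

∈-double : ∀ {F : Family n} {A} → A ∈ F → outside ∷ A ∈ double F
∈-double {F = F} A∈F = ∈-++⁺ʳ (map (inside ∷_) (⊥ ∷ F)) (∈-map⁺ (outside ∷_) A∈F)

c2⇒c1 : C2 → C1
c2⇒c1 c2 n []          (_ , []≢[]) _ _ = contradiction refl []≢[]
c2⇒c1 c2 n F@(A ∷ _) (F! , _)    uc ⊥∉F
  with otherAbundant-or-unique (double F) (Abundant-double-zero F)
... | inj₁ (zero  , 0≢0 , _) = contradiction refl 0≢0
... | inj₁ (suc y , _ , aby) = y , Abundant-double-suc F y aby
... | inj₂ ua = contradiction
  (c2 (suc n) (double F) (double-isFamily F! ⊥∉F) (double-unionClosed uc) (double-⊥∉ ⊥∉F)
      zero ua (outside ∷ A) (∈-double (here refl)))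
  λ ()

large⇒⊥∉ : ∀ {F : Family n} → (∀ A → A ∈ F → 2 ≤ ∣ A ∣) → ⊥ ∉ F
large⇒⊥∉ {n = n} large ⊥∈F = contradiction (subst (2 ≤_) (∣⊥∣≡0 n) (large ⊥ ⊥∈F)) λ ()

abundant-besides-common : C1 → ∀ (F : Family (suc n)) → IsFamily F → UnionClosed F →
                        (∀ A → A ∈ F → 2 ≤ ∣ A ∣) →
                        ∀ x → (∀ {A} → A ∈ F → x S.∈ A) → ∃[ y ] (y ≢ x × Abundant F y)
abundant-besides-common c1 F (F! , F≢[]) uc large x x∈F =
  let y , aby = c1 _ (delete x F) (delete-unique x separates F! , map-≢[] F≢[])
                     (delete-unionClosed x uc) (delete-⊥∉ x small)
  in  punchIn x y , punchInᵢ≢i x y , to (Abundant-delete F x y) aby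
  where
  separates : ∀ {A B} → A ∈ F → B ∈ F → removeAt A x ≡ removeAt B x → lookup A x ≡ lookup B x
  separates A∈F B∈F _ = trans ([]=⇒lookup (x∈F A∈F)) (sym ([]=⇒lookup (x∈F B∈F)))
  small : ∀ {A} → A ∈ F → ¬ A ⊆ ⁅ x ⁆
  small {A} A∈F A⊆⁅x⁆ = n≮n 1
    (≤-trans (large A A∈F) (subst (∣ A ∣ ≤_) (∣⁅x⁆∣≡1 x) (p⊆q⇒∣p∣≤∣q∣ A⊆⁅x⁆)))

c2⇒c4 : C2 → C4
c2⇒c4 c2 n F fam uc large with c2⇒c1 c2 n F fam uc (large⇒⊥∉ large)
c2⇒c4 c2 (suc n) F fam uc large | x , abx =
  let y , y≢x , aby = another in x , y , y≢x ∘ sym , abx , aby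
  where
  another : ∃[ y ] (y ≢ x × Abundant F y)
  another with All.all? (x ∈?_) F | otherAbundant-or-unique F abx
  ... | yes x∈F | _       = abundant-besides-common (c2⇒c1 c2) F fam uc large x (All.lookup x∈F)
  ... | no  _   | inj₁ y  = y
  ... | no  x∉F | inj₂ ua =
    contradiction (All.tabulate (c2 _ F fam uc (large⇒⊥∉ large) x ua _)) x∉F

c4⇒c1 : C4 → C1
c4⇒c1 c4 n F (F! , F≢[]) uc ⊥∉F
  with c4 (suc n) (map (inside ∷_) F) (Unique.map⁺ ∷-injectiveʳ F! , map-≢[] F≢[])
          (map-unionClosed _ (λ _ _ → refl) uc) large
  where
  large : ∀ A' → A' ∈ map (inside ∷_) F → 2 ≤ ∣ A' ∣
  large _ A'∈ with ∈-map⁻ _ A'∈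
  ... | A , A∈F , refl = s≤s (p≢⊥⇒0<∣p∣ λ A≡⊥ → ⊥∉F (subst (_∈ F) A≡⊥ A∈F))
... | zero  , zero  , 0≢0 , _ = contradiction refl 0≢0
... | suc x , _     , _ , abx , _ = x , to (Abundant-map _ F λ _ → ∈-∷) abx
... | zero  , suc y , _ , _ , aby = y , to (Abundant-map _ F λ _ → ∈-∷) aby

c3⇒c2 : C3 → C2
c3⇒c2 c3 (suc n) F fam uc ⊥∉F x ua A A∈F with twins-or-twinFree F
... | inj₂ twinFree =
  let M∈F , ⊆M = ⋃-maximum (proj₂ fam) uc
  in  proj₂ (to (c3 _ F fam uc twinFree ⊥∉F (⋃ F) M∈F ⊆M x ua A) A∈F)
... | inj₁ (a , b , a≢b , tw) =
  let b≢x = twin-≢-uniqueAbundant a≢b tw ua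
  in  to (∈-removeAt A b≢x)
         (c3⇒c2 c3 n (delete b F) (twin-delete-unique a≢b tw (proj₁ fam) , map-≢[] (proj₂ fam))
                (delete-unionClosed b uc) (twin-delete-⊥∉ a≢b tw ⊥∉F)
                (punchOut b≢x) (delete-uniqueAbundant {F = F} b≢x ua)
                (removeAt A b) (∈-map⁺ _ A∈F))

proposition3 : (C3 → C2) × (C2 → C4) × (C4 → C1)
proposition3 = c3⇒c2 , c2⇒c4 , c4⇒c1
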